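{- Let $G$ be a graph, let $(T,\{X_i:i\in V(T)\})$ be a tree decomposition of $G$ of width $k$ with $T$ rooted at a node $r$, and let $b$, $\theta$, $\pi$, $\sigma$ be as in the context. Let $u,v$ be distinct vertices of $G$. Then there do not exist $x_u,y_u\in N_G(u)$ and $x_v,y_v\in N_G(v)$ such that $x_u<_\sigma v<_\sigma y_u$, $x_v<_\sigma u<_\sigma y_v$, $\theta(u)=\theta(x_v)$ and $\theta(v)=\theta(x_u)$.
   Context: A tree decomposition of $G$ is a pair $(T,\{X_i\})$ with $T$ a tree and $X_i\subseteq V(G)$ such that $\bigcup_iX_i=V(G)$, each edge has both ends in some $X_i$, and $X_i\cap X_k\subseteq X_j$ whenever $j$ is on the $T$-path from $i$ to $k$; width is $\max_i|X_i|-1$. In the rooted tree $T$, $u$ is an ancestor of $v$ (and $v$ a descendant of $u$) if $u$ lies on the path from $v$ to the root; every node is its own ancestor and descendant. For $v\in V(G)$, $b(v)$ is the node of $T$ such that $v\in X_{b(v)}$ and $v\notin X_i$ for every proper ancestor $i$ of $b(v)$. $\theta\colon V(G)\to\{0,1,\dots,k\}$ is any function such that for every $i\in V(T)$, distinct vertices of $X_i$ receive distinct values. $\pi$ is a preorder traversal of $T$ (the order in which a depth-first search from the root visits the nodes). $\sigma$ is an ordering of $V(G)$ such that $u<_\sigma v$ whenever $b(u)<_\pi b(v)$ (vertices with equal $b$ ordered arbitrarily); $x<_\sigma y$ means $x$ precedes $y$ in $\sigma$. -}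

module Defs where

open import Data.Nat using (ℕ; zero; suc; _<_; _≤_)
open import Data.Fin using (Fin)
open import Data.Fin.Subset using (Subset; _∈_; _∉_; ∣_∣)
open import Data.Product using (Σ; _×_; ∃; ∃-syntax)
open import Data.Sum using (_⊎_)
open import Relation.Binary.PropositionalEquality using (_≡_; _≢_)
open import Relation.Nullary using (¬_)

iter : {A : Set} → (A → A) → ℕ → A → A
iter f zero    x = x
iter f (suc j) x = f (iter f j x)

record Graph (n : ℕ) : Set₁ where
  field
    Adj   : Fin n → Fin n → Set
    sym   : ∀ {u v} → Adj u v → Adj v u
    irrefl : ∀ {u} → ¬ Adj u u

-- The tree edges are {i , parent i} for i ≢ root; every node reaches
-- the root by iterating parent (so the structure is a tree rooted at root).

record RootedTree (m : ℕ) : Set where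
  field
    root        : Fin m
    parent      : Fin m → Fin m
    parent-root : parent root ≡ root
    reach-root  : ∀ i → ∃[ j ] iter parent j i ≡ root

  -- u is an ancestor of v (reflexive: every node is its own ancestor)
  Ancestor : Fin m → Fin m → Set
  Ancestor u v = ∃[ j ] iter parent j v ≡ u

  ProperAncestor : Fin m → Fin m → Set
  ProperAncestor u v = Ancestor u v × u ≢ v

  -- j lies on the (unique) T-path from i to k: j is an ancestor of i or
  -- of k, and every common ancestor of i and k (in particular their
  -- lowest common ancestor) is an ancestor of j.
  OnPath : Fin m → Fin m → Fin m → Set
  OnPath i k j = (Ancestor j i ⊎ Ancestor j k)
               × (∀ c → Ancestor c i → Ancestor c k → Ancestor c j)

  -- pos is a preorder traversal (DFS order from the root, children in
  -- some order): pos is injective, every node precedes its descendants,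
  -- and the descendants of every node form a contiguous block.
  record IsPreorder (pos : Fin m → ℕ) : Set where
    field
      injective  : ∀ i j → pos i ≡ pos j → i ≡ j
      anc-first  : ∀ u v → Ancestor u v → pos u ≤ pos v
      contiguous : ∀ u v w → Ancestor u v → pos u ≤ pos w → pos w ≤ pos v
                   → Ancestor u w

record TreeDecomposition {n : ℕ} (G : Graph n) (m : ℕ) (T : RootedTree m)
                         (k : ℕ) : Set where
  open Graph G
  open RootedTree T
  field
    bag      : Fin m → Subset n
    covers   : ∀ v → ∃[ i ] v ∈ bag i
    edges    : ∀ u v → Adj u v → ∃[ i ] (u ∈ bag i × v ∈ bag i)
    path     : ∀ i j k' v → OnPath i k' j → v ∈ bag i → v ∈ bag k' → v ∈ bag j
    width≤   : ∀ i → ∣ bag i ∣ ≤ suc k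
    width≥   : ∃[ i ] ∣ bag i ∣ ≡ suc k

module _ {n : ℕ} {G : Graph n} {m : ℕ} {T : RootedTree m} {k : ℕ}
         (D : TreeDecomposition G m T k) where
  open RootedTree T
  open TreeDecomposition D

  IsTopBag : (Fin n → Fin m) → Set
  IsTopBag b = ∀ v → (v ∈ bag (b v))
                   × (∀ i → ProperAncestor i (b v) → v ∉ bag i)

  IsBagColouring : (Fin n → ℕ) → Set
  IsBagColouring θ = (∀ v → θ v ≤ k)
                   × (∀ i u v → u ∈ bag i → v ∈ bag i → u ≢ v → θ u ≢ θ v)

  IsCompatibleOrder : (Fin n → Fin m) → (Fin m → ℕ) → (Fin n → ℕ) → Set
  IsCompatibleOrder b π σ = (∀ u v → σ u ≡ σ v → u ≡ v)
                          × (∀ u v → π (b u) < π (b v) → σ u < σ v)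

-- If σ u < σ v, the neighbour y_u beyond v forces b u to be an ancestor of b v
-- (descendants of a node form a contiguous block of the preorder), and likewise
-- the neighbour x_v before u forces b x_v to be an ancestor of b u.  Since x_v is
-- adjacent to the later vertex v it lies in the bag of b v, hence by the path
-- property also in the bag of b u, next to u.  Two distinct vertices of one bag
-- have distinct colours, contradicting θ u ≡ θ x_v.  The case σ v < σ u is
-- symmetric.
module Submission where

open import Defs
open import Data.Nat using (ℕ; zero; suc; _+_; _∸_; _<_; _≤_; z≤n; s≤s)
open import Data.Nat.Properties
  using (≤-total; ≤-refl; ≤-antisym; <-trans; <-irrefl; <-asym; ≮⇒≥; <-cmp; m∸n+n≡m; anyUpTo?)
open import Data.Fin using (Fin)
open import Data.Fin.Properties using (_≟_)
open import Data.Fin.Subset using (_∈_)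
open import Data.Product using (_×_; ∃; ∃-syntax; _,_; proj₁; proj₂)
open import Data.Sum using (_⊎_; inj₁; inj₂)
open import Function using (_∘_)
open import Relation.Binary using (tri<; tri≈; tri>)
open import Relation.Binary.PropositionalEquality using (_≡_; _≢_; refl; sym; trans; cong)
open import Relation.Nullary using (¬_; Dec; yes; no; contradiction)
open import Relation.Nullary.Decidable using (map′)
open import Relation.Unary using (Decidable)

iter-+ : {A : Set} (f : A → A) (s t : ℕ) (x : A) → iter f (s + t) x ≡ iter f s (iter f t x)
iter-+ f zero    t x = refl
iter-+ f (suc s) t x = cong f (iter-+ f s t x)

iter-∸ : {A : Set} (f : A → A) {s t : ℕ} {x : A} → t ≤ s → iter f s x ≡ iter f (s ∸ t) (iter f t x)
iter-∸ f {s} {t} {x} t≤s =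
  trans (cong (λ j → iter f j x) (sym (m∸n+n≡m t≤s))) (iter-+ f (s ∸ t) t x)

least-satisfying : {P : ℕ → Set} → Decidable P → ∀ {N} → P N
                 → ∃[ t ] P t × (∀ {s} → P s → t ≤ s)
least-satisfying P? {N} pN with P? 0
... | yes p0 = 0 , p0 , λ _ → z≤n
least-satisfying P? {zero}  p0 | no ¬p0 = contradiction p0 ¬p0
least-satisfying P? {suc N} pN | no ¬p0 with least-satisfying (P? ∘ suc) pN
... | t , pt , t-least = suc t , pt , λ { {zero} p0 → contradiction p0 ¬p0
                                        ; {suc s} ps → s≤s (t-least ps) }

module RootedTreeProperties {m : ℕ} (T : RootedTree m) where
  open RootedTree T

  ancestor-trans : ∀ {a j i} → Ancestor a j → Ancestor j i → Ancestor a i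
  ancestor-trans {i = i} (s , p) (t , q) =
    s + t , trans (iter-+ parent s t i) (trans (cong (iter parent s) q) p)

  iter-ancestor : ∀ {s t i} → t ≤ s → Ancestor (iter parent s i) (iter parent t i)
  iter-ancestor {s} {t} t≤s = s ∸ t , sym (iter-∸ parent t≤s)

  ancestors-comparable : ∀ {a c i} → Ancestor a i → Ancestor c i → Ancestor a c ⊎ Ancestor c a
  ancestors-comparable (s , refl) (t , refl) with ≤-total s t
  ... | inj₁ s≤t = inj₂ (iter-ancestor s≤t)
  ... | inj₂ t≤s = inj₁ (iter-ancestor t≤s)

  iter-root : ∀ j → iter parent j root ≡ root
  iter-root zero    = refl
  iter-root (suc j) = trans (cong parent (iter-root j)) parent-root

  iter-past-root : ∀ {s t i} → iter parent t i ≡ root → t ≤ s → iter parent s i ≡ root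
  iter-past-root {s} {t} e t≤s =
    trans (iter-∸ parent t≤s) (trans (cong (iter parent (s ∸ t)) e) (iter-root (s ∸ t)))

  ancestor? : ∀ a i → Dec (Ancestor a i)
  ancestor? a i with reach-root i
  ... | d , i↑d≡root = map′ unbounded bounded (anyUpTo? (λ s → iter parent s i ≟ a) (suc d))
    where
      unbounded : (∃ λ s → s < suc d × iter parent s i ≡ a) → Ancestor a i
      unbounded (s , _ , p) = s , p

      bounded : Ancestor a i → ∃ λ s → s < suc d × iter parent s i ≡ a
      bounded (s , p) with ≤-total s d
      ... | inj₁ s≤d = s , s≤s s≤d , p
      ... | inj₂ d≤s = d , ≤-refl , trans i↑d≡root (trans (sym (iter-past-root i↑d≡root d≤s)) p)

  -- The lowest common ancestor is the first ancestor of i that is an ancestor of w.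
  lowest-common-ancestor : ∀ i w → ∃[ L ] Ancestor L i × Ancestor L w
                                         × (∀ c → Ancestor c i → Ancestor c w → Ancestor c L)
  lowest-common-ancestor i w with reach-root i | reach-root w
  ... | d , i↑d≡root | e , w↑e≡root
    with least-satisfying (λ t → ancestor? (iter parent t i) w) {d} (e , trans w↑e≡root (sym i↑d≡root))
  ... | t , L-w , t-least = iter parent t i , (t , refl) , L-w , λ { _ (s , refl) c-w → iter-ancestor (t-least {s} c-w) }

module DecompositionProperties {n m k : ℕ} {G : Graph n} {T : RootedTree m}
                               (D : TreeDecomposition G m T k) where
  open RootedTree T
  open RootedTreeProperties T
  open TreeDecomposition D

  ∈-bag-between : ∀ {v a j i} → v ∈ bag a → v ∈ bag i → Ancestor a j → Ancestor j i → v ∈ bag j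
  ∈-bag-between {v} {a} {j} {i} v∈a v∈i a-j j-i =
    path a j i v (inj₂ j-i , λ _ c-a _ → ancestor-trans c-a a-j) v∈a v∈i

  module _ {b : Fin n → Fin m} (top : IsTopBag D b) where

    ∈-top-bag : ∀ v → v ∈ bag (b v)
    ∈-top-bag v = proj₁ (top v)

    -- The lowest common ancestor of i and b v lies on the path between them, so
    -- it holds v; minimality of b v leaves only L ≡ b v.
    top-bag-ancestor : ∀ {v i} → v ∈ bag i → Ancestor (b v) i
    top-bag-ancestor {v} {i} v∈i with lowest-common-ancestor i (b v)
    ... | L , L-i , L-bv , lowest with L ≟ b v
    ...   | yes refl = L-i
    ...   | no L≢bv  = contradiction (path i L (b v) v (inj₁ L-i , lowest) v∈i (∈-top-bag v))
                                     (proj₂ (top v) L (L-bv , L≢bv))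

module OrderProperties {n m k : ℕ} {G : Graph n} {T : RootedTree m}
                       (D : TreeDecomposition G m T k)
                       {b : Fin n → Fin m} (top : IsTopBag D b)
                       {π : Fin m → ℕ} (pre : RootedTree.IsPreorder T π)
                       {σ : Fin n → ℕ} (cmp : IsCompatibleOrder D b π σ) where
  open Graph G renaming (sym to Adj-sym)
  open RootedTree T
  open IsPreorder pre
  open RootedTreeProperties T
  open TreeDecomposition D
  open DecompositionProperties D

  π-monotone : ∀ {x y} → σ x < σ y → π (b x) ≤ π (b y)
  π-monotone {x} {y} x<y = ≮⇒≥ λ by<bx → <-asym x<y (proj₂ cmp y x by<bx)

  ancestor-between : ∀ {x y z} → Ancestor (b x) (b z) → σ x < σ y → σ y < σ z → Ancestor (b x) (b y)
  ancestor-between {x} {y} {z} bx-bz x<y y<z =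
    contiguous (b x) (b z) (b y) bx-bz (π-monotone x<y) (π-monotone y<z)

  earlier-neighbour-∈-top-bag : ∀ {x y} → Adj x y → σ x < σ y
                              → Ancestor (b x) (b y) × x ∈ bag (b y)
  earlier-neighbour-∈-top-bag {x} {y} x~y x<y with edges x y x~y
  ... | i , x∈i , y∈i = bx-by , ∈-bag-between (∈-top-bag top x) x∈i bx-by (top-bag-ancestor top y∈i)
    where
      bx-by : Ancestor (b x) (b y)
      bx-by with ancestors-comparable (top-bag-ancestor top x∈i) (top-bag-ancestor top y∈i)
      ... | inj₁ bx-by = bx-by
      ... | inj₂ by-bx = 0 , sym (injective (b x) (b y) (≤-antisym (π-monotone x<y) (anc-first (b y) (b x) by-bx)))

  crossing-colours-differ : {θ : Fin n → ℕ} → IsBagColouring D θ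
                          → ∀ {u v xv yu} → Adj u yu → Adj v xv
                          → σ xv < σ u → σ u < σ v → σ v < σ yu → θ u ≢ θ xv
  crossing-colours-differ col {u} {v} {xv} {yu} u~yu v~xv xv<u u<v v<yu =
    proj₂ col (b u) u xv (∈-top-bag top u) xv∈bu (λ u≡xv → <-irrefl (cong σ (sym u≡xv)) xv<u)
    where
      bu-bv : Ancestor (b u) (b v)
      bu-bv = ancestor-between (proj₁ (earlier-neighbour-∈-top-bag u~yu (<-trans u<v v<yu))) u<v v<yu

      xv-below-v : Ancestor (b xv) (b v) × xv ∈ bag (b v)
      xv-below-v = earlier-neighbour-∈-top-bag (Adj-sym v~xv) (<-trans xv<u u<v)

      xv∈bu : xv ∈ bag (b u)
      xv∈bu = ∈-bag-between (∈-top-bag top xv) (proj₂ xv-below-v)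
                            (ancestor-between (proj₁ xv-below-v) xv<u u<v) bu-bv

open OrderProperties using (crossing-colours-differ)

lemma5 : ∀ {n m k : ℕ} (G : Graph n) (T : RootedTree m)
         (D : TreeDecomposition G m T k)
         (b : Fin n → Fin m) (θ : Fin n → ℕ) (π : Fin m → ℕ) (σ : Fin n → ℕ)
         → IsTopBag D b
         → IsBagColouring D θ
         → RootedTree.IsPreorder T π
         → IsCompatibleOrder D b π σ
         → ∀ (u v : Fin n) → u ≢ v
         → ¬ (∃[ xu ] ∃[ yu ] ∃[ xv ] ∃[ yv ]
                (Graph.Adj G u xu × Graph.Adj G u yu
                 × Graph.Adj G v xv × Graph.Adj G v yv
                 × σ xu < σ v × σ v < σ yu
                 × σ xv < σ u × σ u < σ yv
                 × θ u ≡ θ xv × θ v ≡ θ xu))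
lemma5 G T D b θ π σ top col pre cmp u v u≢v
  (xu , yu , xv , yv , u~xu , u~yu , v~xv , v~yv , xu<v , v<yu , xv<u , u<yv , θu≡θxv , θv≡θxu)
  with <-cmp (σ u) (σ v)
... | tri< u<v _ _     = crossing-colours-differ D top pre cmp col u~yu v~xv xv<u u<v v<yu θu≡θxv
... | tri≈ _ σu≡σv _   = u≢v (proj₁ cmp u v σu≡σv)
... | tri> _ _ v<u     = crossing-colours-differ D top pre cmp col v~yv u~xu xu<v v<u u<yv θv≡θxu
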